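{- Let $n$ be a positive integer and let $w_1 \leq w_2 \leq \dots \leq w_m$ be a feasible partition of $n$. Then for every $i$ with $1 \leq i \leq m$, $w_i \leq 2R_{i-1} + 1$.
   Context: A feasible partition of a positive integer $n$ is a nondecreasing sequence of positive integers $w_1 \leq \dots \leq w_m$ with $w_1 + \dots + w_m = n$ such that (i) every integer $k$ with $1 \leq k \leq n$ can be written as $k = \sum_{i=1}^m u_i w_i$ with each $u_i \in \{ -1,0,1\}$, and (ii) $m$ is the minimum possible number of parts among all sequences of positive integers summing to $n$ with property (i). For such a partition, $R_i = w_1 + \dots + w_i$ for $1 \leq i \leq m$ (so $R_m = n$), and $R_0 = 0$. -}

module Defs where

open import Data.Nat using (ℕ; zero; suc; _+_; _*_; _≤_; _<_)
open import Data.Integer as ℤ using (ℤ; +_)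
open import Data.List using (List; []; _∷_; length; take)
open import Data.Nat.ListAction using (sum)
open import Data.List.Relation.Unary.All using (All)
open import Data.List.Relation.Unary.Sorted.TotalOrder using (Sorted)
open import Data.Nat.Properties using (≤-totalOrder)
open import Data.Product using (Σ; _×_)
open import Relation.Binary.PropositionalEquality using (_≡_)

data Coef : Set where
  neg zer pos : Coef

coefℤ : Coef → ℤ
coefℤ neg = ℤ.-[1+ 0 ]
coefℤ zer = + 0
coefℤ pos = + 1

signedSum : List Coef → List ℕ → ℤ
signedSum (u ∷ us) (w ∷ ws) = coefℤ u ℤ.* (+ w) ℤ.+ signedSum us ws
signedSum _ _ = + 0

Represents : List ℕ → ℕ → Set
Represents ws k = Σ (List Coef) λ us → (length us ≡ length ws) × (signedSum us ws ≡ + k)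

RepresentsAll : ℕ → List ℕ → Set
RepresentsAll n ws = (k : ℕ) → 1 ≤ k → k ≤ n → Represents ws k

Admissible : ℕ → List ℕ → Set
Admissible n ws = All (λ w → 1 ≤ w) ws × (sum ws ≡ n) × RepresentsAll n ws

Feasible : ℕ → List ℕ → Set
Feasible n ws =
  Sorted ≤-totalOrder ws × Admissible n ws ×
  ((vs : List ℕ) → Admissible n vs → length ws ≤ length vs)

R : List ℕ → ℕ → ℕ
R ws i = sum (take i ws)

-- w_i (1-indexed); 0 out of range (never used out of range below).
w : List ℕ → ℕ → ℕ
w [] _ = 0
w (x ∷ xs) zero = 0
w (x ∷ xs) (suc zero) = x
w (x ∷ xs) (suc (suc i)) = w xs (suc i)

module Submission where

open import Defs
open import Data.Nat using (ℕ; zero; suc; _+_; _*_; _∸_; _≤_; _<_; z≤n; s≤s; z<s)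
open import Data.Nat.Properties
open import Data.Integer as ℤ using (+_)
import Data.Integer.Properties as ℤ
open import Data.Integer.Tactic.RingSolver using (solve-∀)
open import Algebra.Properties.CommutativeSemigroup ℤ.+-commutativeSemigroup
  using (interchange)
open import Data.List using (List; []; _∷_; _++_; length; take; drop)
open import Data.List.Properties using (take++drop≡id)
open import Data.Nat.ListAction using (sum)
open import Data.Nat.ListAction.Properties using (sum-++)
open import Data.List.Relation.Unary.All using (All; []; _∷_)
open import Data.List.Relation.Unary.Linked using (Linked; []; [-]; _∷_)
open import Data.List.Relation.Unary.Linked.Properties using (Linked⇒All)
open import Data.Product using (∃-syntax; _,_)
open import Data.Sum using (_⊎_; inj₁; inj₂)
open import Relation.Binary.PropositionalEquality
open import Relation.Nullary using (contradiction)

-- Idea: if k = Σ uᵢ wᵢ then n − k = Σ (1 − uᵢ) wᵢ, a sum of terms in {0, wᵢ, 2wᵢ}.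
-- The terms with index < i contribute at most 2R_{i−1}; since the weights are
-- nondecreasing, the remaining ones contribute 0 or at least wᵢ. Hence n − k never
-- lies strictly between 2R_{i−1} and wᵢ, and if wᵢ > 2R_{i−1} + 1 the value
-- k = n − (2R_{i−1} + 1) is not representable.

deficitTerm : Coef → ℕ → ℕ
deficitTerm neg x = 2 * x
deficitTerm zer x = x
deficitTerm pos x = 0

-- Σ (1 − uᵢ) wᵢ; weights without a coefficient count as uᵢ = 0, matching signedSum.
deficit : List Coef → List ℕ → ℕ
deficit [] ws = sum ws
deficit (u ∷ us) [] = 0
deficit (u ∷ us) (x ∷ xs) = deficitTerm u x + deficit us xs

coefℤ-+-deficitTerm : ∀ u x → coefℤ u ℤ.* + x ℤ.+ + deficitTerm u x ≡ + x
coefℤ-+-deficitTerm neg x = lemma (+ x)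
  where
  -- + (2 * x) is definitionally + x ℤ.+ (+ x ℤ.+ + 0)
  lemma : ∀ a → ℤ.-[1+ 0 ] ℤ.* a ℤ.+ (a ℤ.+ (a ℤ.+ + 0)) ≡ a
  lemma = solve-∀
coefℤ-+-deficitTerm zer x = ℤ.+-identityˡ (+ x)
coefℤ-+-deficitTerm pos x = trans (ℤ.+-identityʳ _) (ℤ.*-identityˡ (+ x))

signedSum-+-deficit : ∀ us ws → signedSum us ws ℤ.+ + deficit us ws ≡ + sum ws
signedSum-+-deficit [] ws = refl
signedSum-+-deficit (u ∷ us) [] = refl
signedSum-+-deficit (u ∷ us) (x ∷ xs) = begin
  (coefℤ u ℤ.* + x ℤ.+ signedSum us xs) ℤ.+ (+ deficitTerm u x ℤ.+ + deficit us xs)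
    ≡⟨ interchange (coefℤ u ℤ.* + x) (signedSum us xs) (+ deficitTerm u x) (+ deficit us xs) ⟩
  (coefℤ u ℤ.* + x ℤ.+ + deficitTerm u x) ℤ.+ (signedSum us xs ℤ.+ + deficit us xs)
    ≡⟨ cong₂ ℤ._+_ (coefℤ-+-deficitTerm u x) (signedSum-+-deficit us xs) ⟩
  + x ℤ.+ + sum xs ∎
  where open ≡-Reasoning

represents⇒deficit : ∀ {ws k} → Represents ws k → ∃[ us ] k + deficit us ws ≡ sum ws
represents⇒deficit {ws} {k} (us , _ , us·ws≡k) =
  us , ℤ.+-injective (trans (cong (ℤ._+ + deficit us ws) (sym us·ws≡k))
                            (signedSum-+-deficit us ws))

deficit-++ : ∀ us xs zs →
  deficit us (xs ++ zs) ≡ deficit (take (length xs) us) xs + deficit (drop (length xs) us) zs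
deficit-++ [] [] zs = refl
deficit-++ [] (x ∷ xs) zs = sum-++ (x ∷ xs) zs
deficit-++ (u ∷ us) [] zs = refl
deficit-++ (u ∷ us) (x ∷ xs) zs = trans (cong (λ t → deficitTerm u x + t) (deficit-++ us xs zs))
                                        (sym (+-assoc (deficitTerm u x) _ _))

deficitTerm≤2* : ∀ u x → deficitTerm u x ≤ 2 * x
deficitTerm≤2* neg x = ≤-refl
deficitTerm≤2* zer x = m≤m+n x (x + 0)
deficitTerm≤2* pos x = z≤n

deficit≤2*sum : ∀ us xs → deficit us xs ≤ 2 * sum xs
deficit≤2*sum [] xs = m≤m+n (sum xs) (sum xs + 0)
deficit≤2*sum (u ∷ us) [] = z≤n
deficit≤2*sum (u ∷ us) (x ∷ xs) =
  subst (deficit (u ∷ us) (x ∷ xs) ≤_) (sym (*-distribˡ-+ 2 x (sum xs)))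
        (+-mono-≤ (deficitTerm≤2* u x) (deficit≤2*sum us xs))

deficit≡0⊎≥ : ∀ {y} us zs → All (y ≤_) zs → deficit us zs ≡ 0 ⊎ y ≤ deficit us zs
deficit≡0⊎≥ [] [] _ = inj₁ refl
deficit≡0⊎≥ [] (z ∷ zs) (y≤z ∷ _) = inj₂ (≤-trans y≤z (m≤m+n z (sum zs)))
deficit≡0⊎≥ (u ∷ us) [] _ = inj₁ refl
deficit≡0⊎≥ (neg ∷ us) (z ∷ zs) (y≤z ∷ _) = inj₂ (≤-trans y≤z (≤-trans (m≤m+n z (z + 0)) (m≤m+n _ _)))
deficit≡0⊎≥ (zer ∷ us) (z ∷ zs) (y≤z ∷ _) = inj₂ (≤-trans y≤z (m≤m+n z _))
deficit≡0⊎≥ (pos ∷ us) (z ∷ zs) (_ ∷ y≤zs) = deficit≡0⊎≥ us zs y≤zs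

deficit-gap : ∀ {y} us xs zs → All (y ≤_) zs →
  2 * sum xs < deficit us (xs ++ zs) → y ≤ deficit us (xs ++ zs)
deficit-gap us xs zs y≤zs 2xs<d
  rewrite deficit-++ us xs zs
  with deficit≡0⊎≥ (drop (length xs) us) zs y≤zs
... | inj₁ suffix≡0 = contradiction prefix≤2xs (<⇒≱ 2xs<prefix)
  where
  prefix = deficit (take (length xs) us) xs
  prefix≤2xs : prefix ≤ 2 * sum xs
  prefix≤2xs = deficit≤2*sum (take (length xs) us) xs
  2xs<prefix : 2 * sum xs < prefix
  2xs<prefix = subst (2 * sum xs <_) (trans (cong (λ s → prefix + s) suffix≡0) (+-identityʳ prefix)) 2xs<d
... | inj₂ y≤suffix = ≤-trans y≤suffix (m≤n+m _ _)

representsAll⇒≤2*sum+1 : ∀ xs y ys → All (y ≤_) ys →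
  RepresentsAll (sum (xs ++ y ∷ ys)) (xs ++ y ∷ ys) → y ≤ 2 * sum xs + 1
representsAll⇒≤2*sum+1 xs y ys y≤ys rep = ≮⇒≥ λ d<y → <⇒≱ d<y (y≤d d<y)
  where
  n = sum (xs ++ y ∷ ys)
  d = 2 * sum xs + 1

  d<n : d < y → d < n
  d<n d<y = begin-strict
    d                     <⟨ d<y ⟩
    y                     ≤⟨ m≤m+n y (sum ys) ⟩
    y + sum ys            ≤⟨ m≤n+m _ (sum xs) ⟩
    sum xs + (y + sum ys) ≡⟨ sum-++ xs (y ∷ ys) ⟨
    n                     ∎
    where open ≤-Reasoning

  y≤d : d < y → y ≤ d
  y≤d d<y with represents⇒deficit (rep (n ∸ d) (m<n⇒0<n∸m (d<n d<y)) (m∸n≤m n d))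
  ... | us , k+D≡n = subst (y ≤_) D≡d
                       (deficit-gap us xs (y ∷ ys) (≤-refl ∷ y≤ys)
                         (subst (2 * sum xs <_) (sym D≡d) (m<m+n _ z<s)))
    where
    D≡d : deficit us (xs ++ y ∷ ys) ≡ d
    D≡d = begin
      deficit us (xs ++ y ∷ ys)                   ≡⟨ m+n∸m≡n (n ∸ d) _ ⟨
      n ∸ d + deficit us (xs ++ y ∷ ys) ∸ (n ∸ d) ≡⟨ cong (_∸ (n ∸ d)) k+D≡n ⟩
      n ∸ (n ∸ d)                                 ≡⟨ m∸[m∸n]≡n (<⇒≤ (d<n d<y)) ⟩
      d                                           ∎
      where open ≡-Reasoning

drop≡w∷drop : ∀ j ws → j < length ws → drop j ws ≡ w ws (suc j) ∷ drop (suc j) ws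
drop≡w∷drop zero (x ∷ xs) _ = refl
drop≡w∷drop (suc j) (x ∷ xs) (s≤s j<∣xs∣) = drop≡w∷drop j xs j<∣xs∣

drop⁺ : ∀ {A : Set} {_≺_ : A → A → Set} j {xs} → Linked _≺_ xs → Linked _≺_ (drop j xs)
drop⁺ zero l = l
drop⁺ (suc j) [] = []
drop⁺ (suc zero) [-] = []
drop⁺ (suc (suc j)) [-] = []
drop⁺ (suc j) (_ ∷ l) = drop⁺ j l

head≤tail : ∀ {y ys} → Linked _≤_ (y ∷ ys) → All (y ≤_) ys
head≤tail [-] = []
head≤tail (y≤z ∷ l) = Linked⇒All ≤-trans y≤z l

theorem2 : (n : ℕ) → 1 ≤ n → (ws : List ℕ) → Feasible n ws →
    (i : ℕ) → 1 ≤ i → i ≤ length ws →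
    w ws i ≤ 2 * R ws (i ∸ 1) + 1
theorem2 n _ ws (sorted , (_ , sum≡n , rep) , _) (suc j) _ i≤∣ws∣ =
  representsAll⇒≤2*sum+1 (take j ws) (w ws (suc j)) (drop (suc j) ws)
    (head≤tail (subst (Linked _≤_) drop-j (drop⁺ j sorted)))
    (subst (λ vs → RepresentsAll (sum vs) vs) ws-split
      (subst (λ m → RepresentsAll m ws) (sym sum≡n) rep))
  where
  drop-j : drop j ws ≡ w ws (suc j) ∷ drop (suc j) ws
  drop-j = drop≡w∷drop j ws i≤∣ws∣

  ws-split : ws ≡ take j ws ++ w ws (suc j) ∷ drop (suc j) ws
  ws-split = trans (sym (take++drop≡id j ws)) (cong (take j ws ++_) drop-j)
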